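{- Let $\mathcal G=(V,\mathcal E)$ be a graph (loops allowed) such that $\mathcal G^0$ is the 5-cycle $C_5$. Then $\mathcal G$ is join-irreducible if and only if $\mathcal G=\mathcal G^0$ (i.e. $\mathcal G$ has no loops).
   Context: A graph $\mathcal G=(V,\mathcal E)$ has finite vertex set $V=\{1,\dots,n\}$ and $\mathcal E\subseteq[V]^2\cup[V]^1$ (singletons are loops); $\mathcal G^0=(V,\mathcal E\cap[V]^2)$. $f_{\mathcal G}$ is the Boolean function computed by the $GF(2)$ polynomial $\sum_{E\in\mathcal E}\prod_{i\in E}x_i$, and $\mathcal G$ is join-irreducible if $f_{\mathcal G}$ is. For Boolean functions, $g\le f$ if there is $\sigma$ with $g(a_1,\dots,a_m)=f(a_{\sigma(1)},\dots,a_{\sigma(n)})$ for all $a_i$; $g<f$ if $g\le f$ and $f\not\le g$; $f$ is join-irreducible if some $f'<f$ satisfies $g\le f'$ for all $g<f$. -}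

module Defs where

open import Data.Nat using (ℕ; zero; suc; _<ᵇ_; _%_; _+_)
open import Data.Bool using (Bool; true; false; _∧_; _∨_; _xor_)
open import Data.Fin using (Fin; toℕ)
open import Data.Fin.Permutation using (Permutation′; _⟨$⟩ʳ_)
open import Data.List using (List; []; _∷_; foldr; map; concatMap; allFin; _++_)
open import Data.Product using (Σ; _×_; _,_)
open import Function using (_∘_)
open import Relation.Nullary using (¬_)
open import Relation.Binary.PropositionalEquality using (_≡_)

BoolFun : Set
BoolFun = Σ ℕ (λ m → (Fin m → Bool) → Bool)

_≤ᴮ_ : BoolFun → BoolFun → Set
(m , g) ≤ᴮ (n , f) = Σ (Fin n → Fin m) (λ σ → ∀ (a : Fin m → Bool) → g a ≡ f (a ∘ σ))

_<ᴮ_ : BoolFun → BoolFun → Set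
g <ᴮ f = (g ≤ᴮ f) × ¬ (f ≤ᴮ g)

JoinIrreducible : BoolFun → Set
JoinIrreducible f = Σ BoolFun (λ f' → (f' <ᴮ f) × (∀ (g : BoolFun) → g <ᴮ f → g ≤ᴮ f'))

-- Graphs with loops on vertex set Fin n.
-- 'edge' is the (symmetric, irreflexive) adjacency of the 2-element edges,
-- 'loop i' says that the singleton {i} is an edge.

record Graph (n : ℕ) : Set where
  field
    edge     : Fin n → Fin n → Bool
    edge-sym : ∀ i j → edge i j ≡ edge j i
    edge-irr : ∀ i → edge i i ≡ false
    loop     : Fin n → Bool
open Graph public

Loopless : ∀ {n} → Graph n → Set
Loopless G = ∀ i → loop G i ≡ false

xorAll : List Bool → Bool
xorAll = foldr _xor_ false

-- Boolean function computed by the GF(2) polynomial Σ_{E∈ℰ} Π_{i∈E} x_i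
fG : ∀ {n} → Graph n → BoolFun
fG {n} G = n , λ x →
  xorAll (map (λ i → loop G i ∧ x i) (allFin n)
          ++ concatMap (λ i → map (λ j → (toℕ i <ᵇ toℕ j) ∧ edge G i j ∧ x i ∧ x j) (allFin n))
                       (allFin n))

c5adj : Fin 5 → Fin 5 → Bool
c5adj i j = (toℕ j Data.Nat.≡ᵇ ((toℕ i + 1) % 5)) ∨ (toℕ i Data.Nat.≡ᵇ ((toℕ j + 1) % 5))

UnderlyingIsC5 : Graph 5 → Set
UnderlyingIsC5 G = Σ (Permutation′ 5) (λ π → ∀ i j → edge G i j ≡ c5adj (π ⟨$⟩ʳ i) (π ⟨$⟩ʳ j))

-- Every strict minor of a Boolean function arises from a non-injective substitution of
-- variables, hence lies below an identification minor, obtained by identifying two variables.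
-- If the function depends on all of its variables, every identification minor is strict, so the
-- function is join-irreducible exactly when one identification minor lies above all others.
-- For the polynomial of C₅ with loops l this is decided by exhaustive search: a greatest
-- identification minor exists precisely when l has no loops. A graph whose loopless part is
-- a relabelled C₅ computes the same function as C₅ with relabelled loops, up to renaming
-- variables.
module Submission where

open import Defs
open import Algebra.Bundles using (CommutativeRing)
open import Data.Bool using (Bool; T; true; false; not; if_then_else_; _∧_; _xor_)
open import Data.Bool.ListAction using (any)
import Data.Bool.Properties as Bool
open import Data.Fin as Fin using (Fin; toℕ; punchIn; punchOut; _<_)
open import Data.Fin.Patterns using (0F; 1F; 2F; 3F; 4F)
open import Data.Fin.Permutation using (Permutation′; _⟨$⟩ʳ_; _⟨$⟩ˡ_; inverseˡ)
open import Data.Fin.Properties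
  using (any?; all?; _≟_; _<?_; <-cmp; <-irrefl; injective⇒≤; punchIn-punchOut)
open import Data.List as List using (List; _++_; map; concatMap; allFin)
open import Data.List.Membership.Propositional using (_∈_)
open import Data.List.Membership.Propositional.Properties using (∈-allFin)
open import Data.List.Properties using (map-cong; concatMap-cong; map-tabulate)
open import Data.List.Relation.Unary.Any as Any using (here; there; satisfied)
open import Data.List.Relation.Unary.Any.Properties using (any⁺; any⁻)
open import Data.Nat as ℕ using (ℕ; suc; _<ᵇ_)
open import Data.Nat.Properties using (<⇒≱; n<1+n)
open import Data.Product using (Σ; ∃; ∃₂; _×_; _,_; proj₁; proj₂)
open import Data.Sum using (_⊎_; inj₁; inj₂)
open import Data.Vec.Functional using (Vector; []; _∷_; head; tail; updateAt)
open import Data.Vec.Functional.Properties using (updateAt-updates; updateAt-minimal)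
open import Function using (_∘_; id; _⇔_; mk⇔; Equivalence)
open import Function.Definitions using (Injective)
open import Function.Properties.Equivalence using (⇔-setoid)
open import Level using (0ℓ)
open import Relation.Binary using (tri<; tri≈; tri>)
open import Relation.Binary.PropositionalEquality
  using (_≡_; _≢_; refl; sym; trans; cong; cong₂; subst; _≗_; module ≡-Reasoning)
import Relation.Binary.Reasoning.Setoid as SetoidReasoning
open import Relation.Nullary using (¬_; Dec; yes; no; does; _because_; invert; contradiction)
open import Relation.Nullary.Decidable
  using (map′; ¬?; _×-dec_; _→-dec_; decidable-stable; from-yes; T?)
open import Relation.Unary using (Pred; Decidable)

open import Algebra.Properties.CommutativeMonoid.Sum
  (CommutativeRing.+-commutativeMonoid Bool.xor-∧-commutativeRing)
  using (sum; sum-cong-≗; sum-permute)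

private
  variable
    m n : ℕ

-- The minor order

Congruent : ((Fin n → Bool) → Bool) → Set
Congruent f = ∀ {a b} → a ≗ b → f a ≡ f b

≤ᴮ-trans : ∀ {f g h} → f ≤ᴮ g → g ≤ᴮ h → f ≤ᴮ h
≤ᴮ-trans (σ , f≡g) (τ , g≡h) = σ ∘ τ , λ a → trans (f≡g a) (g≡h (a ∘ σ))

≤ᴮ-resp-≗ : ∀ {g g′ : (Fin m → Bool) → Bool} {h h′ : (Fin n → Bool) → Bool} →
            g ≗ g′ → h ≗ h′ → (m , g) ≤ᴮ (n , h) → (m , g′) ≤ᴮ (n , h′)
≤ᴮ-resp-≗ g≗g′ h≗h′ (σ , g≡h) = σ , λ a → trans (sym (g≗g′ a)) (trans (g≡h a) (h≗h′ (a ∘ σ)))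

_≈ᴮ_ : BoolFun → BoolFun → Set
f ≈ᴮ g = f ≤ᴮ g × g ≤ᴮ f

<ᴮ-respʳ-≈ᴮ : ∀ {g f f′} → f ≈ᴮ f′ → g <ᴮ f → g <ᴮ f′
<ᴮ-respʳ-≈ᴮ {g} {f} {f′} (f≤f′ , _) (g≤f , f≰g) =
  ≤ᴮ-trans {g} {f} {f′} g≤f f≤f′ , f≰g ∘ ≤ᴮ-trans {f} {f′} {g} f≤f′

joinIrreducible-cong : ∀ {f f′} → f ≈ᴮ f′ → JoinIrreducible f ⇔ JoinIrreducible f′
joinIrreducible-cong (f≤f′ , f′≤f) = mk⇔ (resp (f≤f′ , f′≤f)) (resp (f′≤f , f≤f′))
  where
  resp : ∀ {f f′} → f ≈ᴮ f′ → JoinIrreducible f → JoinIrreducible f′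
  resp {f} {f′} (f≤f′ , f′≤f) (h , h<f , below-h) =
    h , <ᴮ-respʳ-≈ᴮ {h} {f} {f′} (f≤f′ , f′≤f) h<f ,
    λ g g<f′ → below-h g (<ᴮ-respʳ-≈ᴮ {g} {f′} {f} (f′≤f , f≤f′) g<f′)

-- Essential variables

Essential : ((Fin n → Bool) → Bool) → Fin n → Set
Essential f i = ∃ λ a → f a ≢ f (updateAt a i not)

updateAt-cong : ∀ {A : Set} {a b : Vector A n} i (f : A → A) → a ≗ b →
                updateAt a i f ≗ updateAt b i f
updateAt-cong {a = a} {b} i f a≗b k with k ≟ i
... | yes refl = trans (updateAt-updates k a) (trans (cong f (a≗b k)) (sym (updateAt-updates k b)))
... | no k≢i  =
  trans (updateAt-minimal k i a k≢i) (trans (a≗b k) (sym (updateAt-minimal k i b k≢i)))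

essential-resp-≗ : ∀ {f f′ : (Fin n → Bool) → Bool} {i} → f ≗ f′ → Essential f i → Essential f′ i
essential-resp-≗ {i = i} f≗f′ (a , fa≢fa′) =
  a , λ f′a≡f′a′ → fa≢fa′ (trans (f≗f′ a) (trans f′a≡f′a′ (sym (f≗f′ (updateAt a i not)))))

essential⇒∈image : ∀ {g : (Fin m → Bool) → Bool} {h : (Fin n → Bool) → Bool} → Congruent h →
                   ((σ , _) : (m , g) ≤ᴮ (n , h)) → ∀ {i} → Essential g i → ∃ λ k → σ k ≡ i
essential⇒∈image h-cong (σ , g≡h) {i} (a , ga≢ga′) with any? (λ k → σ k ≟ i)
... | yes i∈image = i∈image
... | no  i∉image =
  contradiction (trans (g≡h a) (trans (h-cong untouched) (sym (g≡h (updateAt a i not))))) ga≢ga′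
  where
  untouched : a ∘ σ ≗ updateAt a i not ∘ σ
  untouched k = sym (updateAt-minimal (σ k) i a (λ σk≡i → i∉image (k , σk≡i)))

allEssential⇒≰ᴮ : ∀ {g : (Fin m → Bool) → Bool} {h : (Fin n → Bool) → Bool} → Congruent h →
                  (∀ i → Essential g i) → n ℕ.< m → ¬ ((m , g) ≤ᴮ (n , h))
allEssential⇒≰ᴮ h-cong essential n<m g≤h = <⇒≱ n<m (injective⇒≤ section-injective)
  where
  section : ∀ i → ∃ λ k → proj₁ g≤h k ≡ i
  section i = essential⇒∈image h-cong g≤h (essential i)
  section-injective : Injective _≡_ _≡_ (proj₁ ∘ section)
  section-injective {i} {j} eq =
    trans (sym (proj₂ (section i))) (trans (cong (proj₁ g≤h) eq) (proj₂ (section j)))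

-- Identification minors

-- collapse j t sends variable j to t and renumbers the others, so identify j t f is f with
-- variable j identified with variable punchIn j t. Oriented j t lists each pair only once.
collapse : Fin (suc n) → Fin n → Fin (suc n) → Fin n
collapse j t k with j ≟ k
... | yes _   = t
... | no j≢k = punchOut j≢k

identify : Fin (suc n) → Fin n → ((Fin (suc n) → Bool) → Bool) → BoolFun
identify {n} j t f = n , λ x → f (x ∘ collapse j t)

Oriented : Fin (suc n) → Fin n → Set
Oriented j t = punchIn j t < j

collapse-factor : ∀ {A : Set} {σ : Fin (suc n) → A} j t → σ (punchIn j t) ≡ σ j →
                  ∀ k → σ (punchIn j (collapse j t k)) ≡ σ k
collapse-factor {σ = σ} j t σj′≡σj k with j ≟ k
... | yes refl = σj′≡σj
... | no j≢k  = cong σ (punchIn-punchOut j≢k)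

identify-congruent : ∀ {f : (Fin (suc n) → Bool) → Bool} j t → Congruent f →
                     Congruent (proj₂ (identify j t f))
identify-congruent j t f-cong a≗b = f-cong (a≗b ∘ collapse j t)

identify-<ᴮ : ∀ {f : (Fin (suc n) → Bool) → Bool} j t → Congruent f → (∀ i → Essential f i) →
              identify j t f <ᴮ (suc n , f)
identify-<ᴮ j t f-cong essential =
  (collapse j t , λ _ → refl) , allEssential⇒≰ᴮ (identify-congruent j t f-cong) essential (n<1+n _)

injective⊎collision : (σ : Fin n → Fin m) → Injective _≡_ _≡_ σ ⊎ ∃₂ λ i j → i < j × σ i ≡ σ j
injective⊎collision σ with any? (λ j → any? (λ i → i <? j ×-dec σ i ≟ σ j))
... | yes (j , i , i<j , σi≡σj) = inj₂ (i , j , i<j , σi≡σj)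
... | no no-collision = inj₁ injective
  where
  injective : Injective _≡_ _≡_ σ
  injective {x} {y} σx≡σy with <-cmp x y
  ... | tri< x<y _ _ = contradiction (y , x , x<y , σx≡σy) no-collision
  ... | tri≈ _ x≡y _ = x≡y
  ... | tri> _ _ y<x = contradiction (x , y , y<x , sym σx≡σy) no-collision

injective⇒retraction : (σ : Fin (suc n) → Fin m) → Injective _≡_ _≡_ σ →
                       ∃ λ τ → ∀ i → τ (σ i) ≡ i
injective⇒retraction {n = n} {m = m} σ σ-injective = τ , λ i → choose-σ i (any? λ k → σ k ≟ σ i)
  where
  choose : ∀ y → Dec (∃ λ k → σ k ≡ y) → Fin (suc n)
  choose y (yes (k , _)) = k
  choose y (no _)        = Fin.zero
  τ : Fin m → Fin (suc n)
  τ y = choose y (any? λ k → σ k ≟ y)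
  choose-σ : ∀ i d → choose (σ i) d ≡ i
  choose-σ i (yes (k , σk≡σi)) = σ-injective σk≡σi
  choose-σ i (no i∉image)      = contradiction (i , refl) i∉image

-- An injective substitution would make f a minor of g; a non-injective one factors through
-- the identification of two variables that it sends to the same place.
<ᴮ⇒≤ᴮ-identify : ∀ {g} {f : (Fin (suc n) → Bool) → Bool} → Congruent f → g <ᴮ (suc n , f) →
                 ∃₂ λ j t → Oriented j t × g ≤ᴮ identify j t f
<ᴮ⇒≤ᴮ-identify f-cong ((σ , g≡f) , f≰g) with injective⊎collision σ
... | inj₁ σ-injective =
  let τ , τ∘σ≗id = injective⇒retraction σ σ-injective in
  contradiction (τ , λ a → trans (f-cong (λ i → cong a (sym (τ∘σ≗id i)))) (sym (g≡f (a ∘ τ)))) f≰g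
... | inj₂ (i , j , i<j , σi≡σj) =
  j , t , subst (_< j) (sym (punchIn-punchOut j≢i)) i<j ,
  σ ∘ punchIn j , λ a → trans (g≡f a) (f-cong (λ k → cong a (sym (collapse-factor j t σj′≡σj k))))
  where
  j≢i : j ≢ i
  j≢i j≡i = <-irrefl (sym j≡i) i<j
  t = punchOut j≢i
  σj′≡σj : σ (punchIn j t) ≡ σ j
  σj′≡σj = trans (cong σ (punchIn-punchOut j≢i)) σi≡σj

GreatestIdentification : ((Fin (suc n) → Bool) → Bool) → Set
GreatestIdentification f =
  ∃₂ λ j t → Oriented j t × ∀ j′ t′ → Oriented j′ t′ → identify j′ t′ f ≤ᴮ identify j t f

greatestIdentification-resp-≗ : ∀ {f f′ : (Fin (suc n) → Bool) → Bool} → f ≗ f′ →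
                                GreatestIdentification f → GreatestIdentification f′
greatestIdentification-resp-≗ f≗f′ (j , t , oriented , greatest) =
  j , t , oriented , λ j′ t′ oriented′ →
    ≤ᴮ-resp-≗ (f≗f′ ∘ (_∘ collapse j′ t′)) (f≗f′ ∘ (_∘ collapse j t)) (greatest j′ t′ oriented′)

joinIrreducible⇔greatestIdentification : ∀ {f : (Fin (suc n) → Bool) → Bool} → Congruent f →
  (∀ i → Essential f i) → JoinIrreducible (suc n , f) ⇔ GreatestIdentification f
joinIrreducible⇔greatestIdentification {f = f} f-cong essential = mk⇔ to from
  where
  to : JoinIrreducible (_ , f) → GreatestIdentification f
  to (h , h<f , below-h) =
    let j , t , oriented , h≤Q = <ᴮ⇒≤ᴮ-identify f-cong h<f in
    j , t , oriented , λ j′ t′ _ → ≤ᴮ-trans {identify j′ t′ f} {h} {identify j t f}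
                                     (below-h _ (identify-<ᴮ j′ t′ f-cong essential)) h≤Q
  from : GreatestIdentification f → JoinIrreducible (_ , f)
  from (j , t , _ , greatest) = identify j t f , identify-<ᴮ j t f-cong essential , λ g g<f →
    let j′ , t′ , oriented′ , g≤Q′ = <ᴮ⇒≤ᴮ-identify f-cong g<f in
    ≤ᴮ-trans {g} {identify j′ t′ f} {identify j t f} g≤Q′ (greatest j′ t′ oriented′)

-- Exhaustive search

∷-cong : ∀ {A : Set} x {b c : Vector A n} → b ≗ c → (x ∷ b) ≗ (x ∷ c)
∷-cong x b≗c Fin.zero    = refl
∷-cong x b≗c (Fin.suc i) = b≗c i

head∷tail : ∀ {A : Set} (a : Vector A (suc n)) → (head a ∷ tail a) ≗ a
head∷tail a Fin.zero    = refl
head∷tail a (Fin.suc i) = refl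

RespectsPointwise : ∀ {A : Set} → Pred (Vector A n) _ → Set
RespectsPointwise P = ∀ {f g} → f ≗ g → P f → P g

Enumeration : Set → Set
Enumeration A = Σ (List A) λ xs → ∀ x → x ∈ xs

Bool-enumeration : Enumeration Bool
Bool-enumeration =
  false List.∷ true List.∷ List.[] , λ { false → here refl ; true → there (here refl) }

Fin-enumeration : ∀ n → Enumeration (Fin n)
Fin-enumeration n = allFin n , ∈-allFin

does⇒ : ∀ {A : Set} (a? : Dec A) → T (does a?) → A
does⇒ (true because [a]) _ = invert [a]

⇒does : ∀ {A : Set} (a? : Dec A) → A → T (does a?)
⇒does (true  because _)    _ = _
⇒does (false because [¬a]) a = invert [¬a] a

-- The search runs on booleans and reflects only its final answer: composing Decs instead makes
-- the type checker retain the whole search tree.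
anyᵛ : ∀ {A : Set} → List A → ∀ n → (Vector A n → Bool) → Bool
anyᵛ xs ℕ.zero  p = p []
anyᵛ xs (suc n) p = any (λ x → anyᵛ xs n (p ∘ (x ∷_))) xs

anyᵛ-sound : ∀ {A : Set} xs n (p : Vector A n → Bool) → T (anyᵛ xs n p) → ∃ λ f → T (p f)
anyᵛ-sound xs ℕ.zero  p t = [] , t
anyᵛ-sound xs (suc n) p t =
  let x , t′ = satisfied (any⁻ _ xs t)
      f , t″ = anyᵛ-sound xs n (p ∘ (x ∷_)) t′
  in x ∷ f , t″

anyᵛ-complete : ∀ {A : Set} ((xs , _) : Enumeration A) n {p : Vector A n → Bool} →
                RespectsPointwise (T ∘ p) → ∀ f → T (p f) → T (anyᵛ xs n p)
anyᵛ-complete _ ℕ.zero p-resp f t = p-resp (λ ()) t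
anyᵛ-complete E@(xs , complete) (suc n) p-resp f t =
  any⁺ _ (Any.map (λ { refl → anyᵛ-complete E n (p-resp ∘ ∷-cong (head f)) (tail f)
                                               (p-resp (sym ∘ head∷tail f) t) })
                  (complete (head f)))

any-Vector? : ∀ {A} → Enumeration A → ∀ n {P : Pred (Vector A n) _} → RespectsPointwise P →
              Decidable P → Dec (∃ P)
any-Vector? E@(xs , _) n P-resp P? =
  map′ (λ t → let f , t′ = anyᵛ-sound xs n _ t in f , does⇒ (P? f) t′)
       (λ (f , p) → anyᵛ-complete E n (λ f≗g → ⇒does (P? _) ∘ P-resp f≗g ∘ does⇒ (P? _))
                                      f (⇒does (P? f) p))
       (T? (anyᵛ xs n (does ∘ P?)))

all-Vector? : ∀ {A} → Enumeration A → ∀ n {P : Pred (Vector A n) _} → RespectsPointwise P →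
              Decidable P → Dec (∀ f → P f)
all-Vector? E n P-resp P? =
  map′ (λ no-counterexample f → decidable-stable (P? f) (λ ¬p → no-counterexample (f , ¬p)))
       (λ ∀P (f , ¬p) → ¬p (∀P f))
       (¬? (any-Vector? E n (λ f≗g ¬pf pg → ¬pf (P-resp (sym ∘ f≗g) pg)) (¬? ∘ P?)))

≗? : {g h : (Fin n → Bool) → Bool} → Congruent g → Congruent h → Dec (g ≗ h)
≗? {n} {g} {h} g-cong h-cong =
  all-Vector? Bool-enumeration n (λ a≗b ga≡ha → trans (sym (g-cong a≗b)) (trans ga≡ha (h-cong a≗b)))
              (λ a → g a Bool.≟ h a)

injective? : (σ : Fin n → Fin m) → Dec (Injective _≡_ _≡_ σ)
injective? σ with injective⊎collision σ
... | inj₁ σ-injective          = yes σ-injective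
... | inj₂ (_ , _ , i<j , σi≡σj) = no λ σ-injective → <-irrefl (σ-injective σi≡σj) i<j

essential? : ∀ {f : (Fin n → Bool) → Bool} → Congruent f → ∀ i → Dec (Essential f i)
essential? {n} {f} f-cong i =
  any-Vector? Bool-enumeration n resp λ a → ¬? (f a Bool.≟ f (updateAt a i not))
  where
  resp : RespectsPointwise λ a → f a ≢ f (updateAt a i not)
  resp a≗b fa≢fa′ fb≡fb′ =
    fa≢fa′ (trans (f-cong a≗b) (trans fb≡fb′ (sym (f-cong (updateAt-cong i not a≗b)))))

-- The searches below compare functions through their truth tables, which are computed once.
data TruthTable : ℕ → Set where
  leaf : Bool → TruthTable 0
  node : TruthTable n → TruthTable n → TruthTable (suc n)

truthTable : ∀ n → ((Fin n → Bool) → Bool) → TruthTable n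
truthTable ℕ.zero  f = leaf (f [])
truthTable (suc n) f = node (truthTable n (f ∘ (false ∷_))) (truthTable n (f ∘ (true ∷_)))

evaluate : TruthTable n → (Fin n → Bool) → Bool
evaluate (leaf b)   a = b
evaluate (node t u) a = evaluate (if head a then u else t) (tail a)

evaluate-congruent : (t : TruthTable n) → Congruent (evaluate t)
evaluate-congruent (leaf b)   _   = refl
evaluate-congruent (node t u) {b = b} a≗b rewrite a≗b Fin.zero =
  evaluate-congruent (if head b then u else t) (a≗b ∘ Fin.suc)

evaluate-truthTable : ∀ {f : (Fin n → Bool) → Bool} → Congruent f → evaluate (truthTable n f) ≗ f
evaluate-truthTable {ℕ.zero}        f-cong a = f-cong λ ()
evaluate-truthTable {suc n} {f = f} f-cong a =
  trans (cong (λ t → evaluate t (tail a)) (select-branch (head a)))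
        (trans (evaluate-truthTable (λ b≗c → f-cong (∷-cong (head a) b≗c)) (tail a))
               (f-cong (head∷tail a)))
  where
  select-branch : ∀ x → (if x then truthTable n (f ∘ (true ∷_)) else truthTable n (f ∘ (false ∷_)))
                        ≡ truthTable n (f ∘ (x ∷_))
  select-branch false = refl
  select-branch true  = refl

≤ᵀ? : (G : TruthTable m) (H : TruthTable n) → Dec ((m , evaluate G) ≤ᴮ (n , evaluate H))
≤ᵀ? {n = n} G H =
  any-Vector? (Fin-enumeration _) n σ-resp λ σ →
    ≗? (evaluate-congruent G) (evaluate-congruent H ∘ (_∘ σ))
  where
  σ-resp : RespectsPointwise (λ σ → ∀ a → evaluate G a ≡ evaluate H (a ∘ σ))
  σ-resp σ≗τ G≡Hσ a = trans (G≡Hσ a) (evaluate-congruent H (cong a ∘ σ≗τ))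

≤ᴮ? : ∀ {g : (Fin m → Bool) → Bool} {h : (Fin n → Bool) → Bool} → Congruent g → Congruent h →
      Dec ((m , g) ≤ᴮ (n , h))
≤ᴮ? {m} {n} {g} {h} g-cong h-cong =
  map′ (≤ᴮ-resp-≗ (evaluate-truthTable g-cong) (evaluate-truthTable h-cong))
       (≤ᴮ-resp-≗ (sym ∘ evaluate-truthTable g-cong) (sym ∘ evaluate-truthTable h-cong))
       (≤ᵀ? (truthTable m g) (truthTable n h))

greatestIdentificationᵀ? : (F : TruthTable (suc n)) → Dec (GreatestIdentification (evaluate F))
greatestIdentificationᵀ? F =
  any? λ j → any? λ t → (punchIn j t <? j) ×-dec
    all? λ j′ → all? λ t′ → (punchIn j′ t′ <? j′) →-dec
      ≤ᴮ? (identify-congruent j′ t′ (evaluate-congruent F))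
          (identify-congruent j t (evaluate-congruent F))

greatestIdentification? : ∀ {f : (Fin (suc n) → Bool) → Bool} → Congruent f →
                          Dec (GreatestIdentification f)
greatestIdentification? {n} {f} f-cong =
  map′ (greatestIdentification-resp-≗ (evaluate-truthTable f-cong))
       (greatestIdentification-resp-≗ (sym ∘ evaluate-truthTable f-cong))
       (greatestIdentificationᵀ? (truthTable (suc n) f))

-- The function of a graph

loopForm : (Fin n → Bool) → (Fin n → Bool) → Bool
loopForm {n} l x = xorAll (map (λ i → l i ∧ x i) (allFin n))

edgeForm : (Fin n → Fin n → Bool) → (Fin n → Bool) → Bool
edgeForm {n} e x =
  xorAll (concatMap (λ i → map (λ j → (toℕ i <ᵇ toℕ j) ∧ e i j ∧ x i ∧ x j) (allFin n)) (allFin n))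

xorAll-++ : ∀ xs ys → xorAll (xs ++ ys) ≡ xorAll xs xor xorAll ys
xorAll-++ List.[]         ys = refl
xorAll-++ (x List.∷ xs) ys = trans (cong (x xor_) (xorAll-++ xs ys)) (sym (Bool.xor-assoc x _ _))

fG-split : ∀ (G : Graph n) x → proj₂ (fG G) x ≡ loopForm (loop G) x xor edgeForm (edge G) x
fG-split {n} G x = xorAll-++ (map (λ i → loop G i ∧ x i) (allFin n)) _

loopForm-cong : ∀ {l l′ x y : Fin n → Bool} → l ≗ l′ → x ≗ y → loopForm l x ≡ loopForm l′ y
loopForm-cong {n} l≗l′ x≗y = cong xorAll (map-cong (λ i → cong₂ _∧_ (l≗l′ i) (x≗y i)) (allFin n))

edgeForm-cong : ∀ {e e′ : Fin n → Fin n → Bool} {x y} → (∀ i j → e i j ≡ e′ i j) → x ≗ y →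
                edgeForm e x ≡ edgeForm e′ y
edgeForm-cong {n} e≡e′ x≗y = cong xorAll (concatMap-cong (λ i → map-cong (λ j →
  cong₂ (λ u v → (toℕ i <ᵇ toℕ j) ∧ u ∧ v) (e≡e′ i j) (cong₂ _∧_ (x≗y i) (x≗y j)))
  (allFin n)) (allFin n))

fG-congruent : (G : Graph n) → Congruent (proj₂ (fG G))
fG-congruent G {a} {b} a≗b = begin
  proj₂ (fG G) a                               ≡⟨ fG-split G a ⟩
  loopForm (loop G) a xor edgeForm (edge G) a  ≡⟨ cong₂ _xor_ (loopForm-cong (λ _ → refl) a≗b)
                                                   (edgeForm-cong {e = edge G} (λ _ _ → refl) a≗b) ⟩
  loopForm (loop G) b xor edgeForm (edge G) b  ≡⟨ fG-split G b ⟨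
  proj₂ (fG G) b                               ∎
  where open ≡-Reasoning

xorAll-tabulate : ∀ n (h : Fin n → Bool) → xorAll (List.tabulate h) ≡ sum h
xorAll-tabulate ℕ.zero  h = refl
xorAll-tabulate (suc n) h = cong (h Fin.zero xor_) (xorAll-tabulate n (h ∘ Fin.suc))

loopForm-permute : ∀ (π : Permutation′ n) l x →
                   loopForm l (x ∘ (π ⟨$⟩ʳ_)) ≡ loopForm (l ∘ (π ⟨$⟩ˡ_)) x
loopForm-permute {n} π l x = begin
  loopForm l (x ∘ (π ⟨$⟩ʳ_))                       ≡⟨ as-sum (λ i → l i ∧ x (π ⟨$⟩ʳ i)) ⟩
  sum (λ i → l i ∧ x (π ⟨$⟩ʳ i))                   ≡⟨ sum-cong-≗ cancel-π ⟨
  sum (λ i → l (π ⟨$⟩ˡ (π ⟨$⟩ʳ i)) ∧ x (π ⟨$⟩ʳ i)) ≡⟨ sum-permute (λ k → l (π ⟨$⟩ˡ k) ∧ x k) π ⟨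
  sum (λ k → l (π ⟨$⟩ˡ k) ∧ x k)                   ≡⟨ as-sum (λ k → l (π ⟨$⟩ˡ k) ∧ x k) ⟨
  loopForm (l ∘ (π ⟨$⟩ˡ_)) x                       ∎
  where
  open ≡-Reasoning
  as-sum : ∀ h → xorAll (map h (allFin n)) ≡ sum h
  as-sum h = trans (cong xorAll (map-tabulate id h)) (xorAll-tabulate n h)
  cancel-π : ∀ i → l (π ⟨$⟩ˡ (π ⟨$⟩ʳ i)) ∧ x (π ⟨$⟩ʳ i) ≡ l i ∧ x (π ⟨$⟩ʳ i)
  cancel-π i = cong (λ k → l k ∧ x (π ⟨$⟩ʳ i)) (inverseˡ π)

-- The 5-cycle

c5adj-sym : ∀ i j → c5adj i j ≡ c5adj j i
c5adj-sym i j = Bool.∨-comm (toℕ j ℕ.≡ᵇ (toℕ i ℕ.+ 1) ℕ.% 5) _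

c5adj-irreflexive : ∀ i → c5adj i i ≡ false
c5adj-irreflexive 0F = refl
c5adj-irreflexive 1F = refl
c5adj-irreflexive 2F = refl
c5adj-irreflexive 3F = refl
c5adj-irreflexive 4F = refl

C₅ : (Fin 5 → Bool) → Graph 5
C₅ l = record
  { edge     = c5adj
  ; edge-sym = c5adj-sym
  ; edge-irr = c5adj-irreflexive
  ; loop     = l
  }

C₅-function : (Fin 5 → Bool) → (Fin 5 → Bool) → Bool
C₅-function l = proj₂ (fG (C₅ l))

C₅-function-cong : ∀ {l l′} → l ≗ l′ → C₅-function l ≗ C₅-function l′
C₅-function-cong {l} {l′} l≗l′ x = begin
  C₅-function l x                     ≡⟨ fG-split (C₅ l) x ⟩
  loopForm l x xor edgeForm c5adj x   ≡⟨ cong (_xor edgeForm c5adj x)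
                                             (loopForm-cong {x = x} l≗l′ λ _ → refl) ⟩
  loopForm l′ x xor edgeForm c5adj x  ≡⟨ fG-split (C₅ l′) x ⟨
  C₅-function l′ x                    ∎
  where open ≡-Reasoning

edgeForm-C₅-relabel : ∀ (v : Fin 5 → Fin 5) → Injective _≡_ _≡_ v →
                      ∀ x → edgeForm (λ i j → c5adj (v i) (v j)) (x ∘ v) ≡ edgeForm c5adj x
edgeForm-C₅-relabel = from-yes (all-Vector? (Fin-enumeration 5) 5 resp λ v → injective? v →-dec
  ≗? (λ x≗y → edgeForm-cong {e = λ i j → c5adj (v i) (v j)} (λ _ _ → refl) (x≗y ∘ v))
     (edgeForm-cong {e = c5adj} (λ _ _ → refl)))
  where
  resp : RespectsPointwise λ v → Injective _≡_ _≡_ v → ∀ x →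
           edgeForm (λ i j → c5adj (v i) (v j)) (x ∘ v) ≡ edgeForm c5adj x
  resp v≗w relabel w-injective x =
    trans (edgeForm-cong (λ i j → cong₂ c5adj (sym (v≗w i)) (sym (v≗w j))) (cong x ∘ sym ∘ v≗w))
          (relabel (λ vi≡vj → w-injective (trans (sym (v≗w _)) (trans vi≡vj (v≗w _)))) x)

C₅-essential : ∀ l i → Essential (C₅-function l) i
C₅-essential =
  from-yes (all-Vector? Bool-enumeration 5 resp λ l → all? (essential? (fG-congruent (C₅ l))))
  where
  resp : RespectsPointwise λ l → ∀ i → Essential (C₅-function l) i
  resp l≗l′ essential i = essential-resp-≗ {i = i} (C₅-function-cong l≗l′) (essential i)

C₅-greatestIdentification⇔loopless : ∀ l →
  GreatestIdentification (C₅-function l) ⇔ (∀ i → l i ≡ false)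
C₅-greatestIdentification⇔loopless l = mk⇔ (proj₁ (check l)) (proj₂ (check l))
  where
  P : Pred (Fin 5 → Bool) _
  P l = (GreatestIdentification (C₅-function l) → ∀ i → l i ≡ false) ×
        ((∀ i → l i ≡ false) → GreatestIdentification (C₅-function l))
  resp : RespectsPointwise P
  resp l≗l′ (to , from) =
    (λ greatest i → trans (sym (l≗l′ i))
      (to (greatestIdentification-resp-≗ (sym ∘ C₅-function-cong l≗l′) greatest) i)) ,
    (λ loopless → greatestIdentification-resp-≗ (C₅-function-cong l≗l′)
                    (from λ i → trans (l≗l′ i) (loopless i)))
  P? : Decidable P
  P? l = let greatest? = greatestIdentification? (fG-congruent (C₅ l))
             loopless? = all? λ i → l i Bool.≟ false
         in (greatest? →-dec loopless?) ×-dec (loopless? →-dec greatest?)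
  check : ∀ l → P l
  check = from-yes (all-Vector? Bool-enumeration 5 resp P?)

fG≈ᴮC₅ : (G : Graph 5) ((π , _) : UnderlyingIsC5 G) → fG G ≈ᴮ fG (C₅ (loop G ∘ (π ⟨$⟩ˡ_)))
fG≈ᴮC₅ G (π , edge≡c5adj) =
  ((π ⟨$⟩ˡ_) , λ a → trans (fG-congruent G (λ i → cong a (sym (inverseˡ π {i}))))
                            (relabel (a ∘ (π ⟨$⟩ˡ_)))) ,
  ((π ⟨$⟩ʳ_) , sym ∘ relabel)
  where
  l′ = loop G ∘ (π ⟨$⟩ˡ_)
  π-injective : Injective _≡_ _≡_ (π ⟨$⟩ʳ_)
  π-injective πi≡πj = trans (sym (inverseˡ π)) (trans (cong (π ⟨$⟩ˡ_) πi≡πj) (inverseˡ π))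
  relabel : ∀ a → proj₂ (fG G) (a ∘ (π ⟨$⟩ʳ_)) ≡ C₅-function l′ a
  relabel a = begin
    proj₂ (fG G) (a ∘ (π ⟨$⟩ʳ_))
      ≡⟨ fG-split G (a ∘ (π ⟨$⟩ʳ_)) ⟩
    loopForm (loop G) (a ∘ (π ⟨$⟩ʳ_)) xor edgeForm (edge G) (a ∘ (π ⟨$⟩ʳ_))
      ≡⟨ cong₂ _xor_ (loopForm-permute π (loop G) a)
                     (edgeForm-cong {x = a ∘ (π ⟨$⟩ʳ_)} edge≡c5adj (λ _ → refl)) ⟩
    loopForm l′ a xor edgeForm (λ i j → c5adj (π ⟨$⟩ʳ i) (π ⟨$⟩ʳ j)) (a ∘ (π ⟨$⟩ʳ_))
      ≡⟨ cong (loopForm l′ a xor_) (edgeForm-C₅-relabel (π ⟨$⟩ʳ_) π-injective a) ⟩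
    loopForm l′ a xor edgeForm c5adj a
      ≡⟨ fG-split (C₅ l′) a ⟨
    C₅-function l′ a
      ∎
    where open ≡-Reasoning

proposition4p14 : (G : Graph 5) → UnderlyingIsC5 G →
    (JoinIrreducible (fG G) → Loopless G) × (Loopless G → JoinIrreducible (fG G))
proposition4p14 G isC5@(π , _) = Equivalence.to ji⇔loopless , Equivalence.from ji⇔loopless
  where
  l′ = loop G ∘ (π ⟨$⟩ˡ_)
  l′-loopless⇔loopless : (∀ i → l′ i ≡ false) ⇔ Loopless G
  l′-loopless⇔loopless = mk⇔
    (λ l′≡false i → subst (λ k → loop G k ≡ false) (inverseˡ π) (l′≡false (π ⟨$⟩ʳ i)))
    (λ loopless → loopless ∘ (π ⟨$⟩ˡ_))
  ji⇔loopless : JoinIrreducible (fG G) ⇔ Loopless G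
  ji⇔loopless = begin
    JoinIrreducible (fG G)                   ≈⟨ joinIrreducible-cong (fG≈ᴮC₅ G isC5) ⟩
    JoinIrreducible (fG (C₅ l′))             ≈⟨ joinIrreducible⇔greatestIdentification
                                                  (fG-congruent (C₅ l′)) (C₅-essential l′) ⟩
    GreatestIdentification (C₅-function l′)  ≈⟨ C₅-greatestIdentification⇔loopless l′ ⟩
    (∀ i → l′ i ≡ false)                     ≈⟨ l′-loopless⇔loopless ⟩
    Loopless G                               ∎
    where open SetoidReasoning (⇔-setoid 0ℓ)
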